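{- Let $s,t,k,u,v$ be integers with $0\le s\le t\le k$ and $u,v\ge1$. If there exists an AOA$(s,t,k,v)$ and an AOA$(s,t,k,u)$, then there exists an AOA$(s,t,k,uv)$.
   Context: An orthogonal array OA$(t,k,v)$ is a $v^t\times k$ array with entries from a set $X$ of size $v$ such that the restriction to any $t$ columns contains every $t$-tuple of $X^t$ exactly once. An AOA$(s,t,k,v)$ is a $v^t\times (k+1)$ array $A$ such that: (1) the first $k$ columns form an OA$(t,k,v)$ on a set $X$ with $|X|=v$; (2) the last column has symbols from a set $Y$ with $|Y|=v^{t-s}$; (3) any $s$ of the first $k$ columns together with the last column contain every $(s+1)$-tuple of $X^s\times Y$ exactly once. -}

module Defs where

open import Data.Nat using (ℕ; _^_; _∸_)
open import Data.Fin using (Fin)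
open import Data.Product using (Σ; _×_; _,_; proj₁)
import Data.Product
open import Function.Definitions using (Injective)
open import Relation.Binary.PropositionalEquality using (_≡_)

Array : ℕ → ℕ → ℕ → Set
Array N k v = Fin N → Fin k → Fin v

ExactlyOne : {N : ℕ} → (Fin N → Set) → Set
ExactlyOne {N} P = Σ (Fin N) λ r → P r × (∀ r′ → P r′ → r′ ≡ r)

Columns : ℕ → ℕ → Set
Columns m k = Σ (Fin m → Fin k) λ f → Injective _≡_ _≡_ f

IsOA : (t k v : ℕ) → Array (v ^ t) k v → Set
IsOA t k v A =
  (cols : Columns t k) → (x : Fin t → Fin v) →
  ExactlyOne (λ r → ∀ i → A r (proj₁ cols i) ≡ x i)

record AOA (s t k v : ℕ) : Set where
  field
    arr  : Array (v ^ t) k v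
    last : Fin (v ^ t) → Fin (v ^ (t ∸ s))
    isOA : IsOA t k v arr
    augmented :
      (cols : Columns s k) → (x : Fin s → Fin v) → (y : Fin (v ^ (t ∸ s))) →
      ExactlyOne (λ r → (∀ i → arr r (Data.Product.proj₁ cols i) ≡ x i) × last r ≡ y)

-- Take the "product" of the two arrays: rows, symbols and last-column labels
-- of the new array are pairs of those of the factors, via the bijections
-- Fin ((u * v) ^ e) ≅ Fin (u ^ e) × Fin (v ^ e). A tuple of pair symbols is
-- hit by a row exactly when both its components are hit by the corresponding
-- component rows, so uniqueness and existence both split into the two factors.
module Submission where

open import Defs
open import Algebra.Properties.CommutativeSemigroup using (interchange)
open import Data.Nat using (ℕ; _≤_; _*_; _^_; _∸_; zero; suc)
open import Data.Nat.Properties using (*-commutativeSemigroup)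
open import Data.Fin using (Fin)
open import Data.Fin.Properties using (*↔×)
open import Data.Product using (_×_; _,_; proj₁; proj₂)
open import Data.Product.Properties using (×-≡,≡→≡; ×-≡,≡←≡)
open import Function.Bundles using (_↔_; _⇔_; mk⇔; Inverse; Equivalence)
open import Relation.Binary.PropositionalEquality using (_≡_; refl; sym; trans; cong; subst)

^-distribʳ-* : ∀ m n e → (m * n) ^ e ≡ m ^ e * n ^ e
^-distribʳ-* m n zero    = refl
^-distribʳ-* m n (suc e) =
  trans (cong (m * n *_) (^-distribʳ-* m n e))
        (interchange *-commutativeSemigroup m n (m ^ e) (n ^ e))

^↔× : ∀ m n e → Fin ((m * n) ^ e) ↔ (Fin (m ^ e) × Fin (n ^ e))
^↔× m n e =
  subst (λ N → Fin N ↔ (Fin (m ^ e) × Fin (n ^ e))) (sym (^-distribʳ-* m n e)) *↔×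

module _ {A B C : Set} (ι : A ↔ (B × C)) where
  open Inverse ι

  from-≡⇔ : ∀ {b c x} → from (b , c) ≡ x ⇔ (b ≡ proj₁ (to x) × c ≡ proj₂ (to x))
  from-≡⇔ = mk⇔ (λ eq → ×-≡,≡←≡ (sym (inverseˡ (sym eq))))
                (λ eqs → inverseʳ (×-≡,≡→≡ eqs))

Agrees : ∀ {N j k v} → Array N k v → (Fin j → Fin k) → (Fin j → Fin v) → Fin N → Set
Agrees A f x r = ∀ i → A r (f i) ≡ x i

module _ {N : ℕ} where

  ExactlyOne-resp : {P Q : Fin N → Set} → (∀ r → P r ⇔ Q r) → ExactlyOne P → ExactlyOne Q
  ExactlyOne-resp P⇔Q (r , p , unique) =
    r , Equivalence.to (P⇔Q r) p , λ r′ q → unique r′ (Equivalence.from (P⇔Q r′) q)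

  ExactlyOne-× : ∀ {n₁ n₂} (ι : Fin N ↔ (Fin n₁ × Fin n₂))
    {P : Fin n₁ → Set} {Q : Fin n₂ → Set} → ExactlyOne P → ExactlyOne Q →
    ExactlyOne (λ r → P (proj₁ (Inverse.to ι r)) × Q (proj₂ (Inverse.to ι r)))
  ExactlyOne-× ι {P} {Q} (r₁ , p , unique₁) (r₂ , q , unique₂) =
    from (r₁ , r₂) ,
    subst (λ (a , b) → P a × Q b) (sym (inverseˡ refl)) (p , q) ,
    λ r (p′ , q′) → sym (inverseʳ (sym (×-≡,≡→≡ (unique₁ _ p′ , unique₂ _ q′))))
    where open Inverse ι

module Product {s t k m n} (A : AOA s t k m) (B : AOA s t k n) where
  private
    module A = AOA A
    module B = AOA B

    rows : Fin ((m * n) ^ t) ↔ (Fin (m ^ t) × Fin (n ^ t))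
    rows = ^↔× m n t

    symbols : Fin (m * n) ↔ (Fin m × Fin n)
    symbols = *↔×

    labels : Fin ((m * n) ^ (t ∸ s)) ↔ (Fin (m ^ (t ∸ s)) × Fin (n ^ (t ∸ s)))
    labels = ^↔× m n (t ∸ s)

    module Rows    = Inverse rows
    module Symbols = Inverse symbols
    module Labels  = Inverse labels

    rowA : Fin ((m * n) ^ t) → Fin (m ^ t)
    rowA r = proj₁ (Rows.to r)

    rowB : Fin ((m * n) ^ t) → Fin (n ^ t)
    rowB r = proj₂ (Rows.to r)

    symbolA : Fin (m * n) → Fin m
    symbolA x = proj₁ (Symbols.to x)

    symbolB : Fin (m * n) → Fin n
    symbolB x = proj₂ (Symbols.to x)

  arr : Array ((m * n) ^ t) k (m * n)
  arr r c = Symbols.from (A.arr (rowA r) c , B.arr (rowB r) c)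

  last : Fin ((m * n) ^ t) → Fin ((m * n) ^ (t ∸ s))
  last r = Labels.from (A.last (rowA r) , B.last (rowB r))

  Agrees-pair⇔ : ∀ {j} (f : Fin j → Fin k) (x : Fin j → Fin (m * n)) r →
    (Agrees A.arr f (λ i → symbolA (x i)) (rowA r) × Agrees B.arr f (λ i → symbolB (x i)) (rowB r))
      ⇔ Agrees arr f x r
  Agrees-pair⇔ f x r = mk⇔
    (λ (agreeA , agreeB) i → Equivalence.from (from-≡⇔ symbols) (agreeA i , agreeB i))
    (λ agree → (λ i → proj₁ (Equivalence.to (from-≡⇔ symbols) (agree i)))
             , (λ i → proj₂ (Equivalence.to (from-≡⇔ symbols) (agree i))))

  isOA : IsOA t k (m * n) arr
  isOA cols x =
    ExactlyOne-resp (Agrees-pair⇔ (proj₁ cols) x)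
      (ExactlyOne-× rows (A.isOA cols (λ i → symbolA (x i))) (B.isOA cols (λ i → symbolB (x i))))

  augmented : (cols : Columns s k) (x : Fin s → Fin (m * n)) (y : Fin ((m * n) ^ (t ∸ s))) →
    ExactlyOne (λ r → Agrees arr (proj₁ cols) x r × last r ≡ y)
  augmented cols x y =
    ExactlyOne-resp split⇔
      (ExactlyOne-× rows
        (A.augmented cols (λ i → symbolA (x i)) (proj₁ (Labels.to y)))
        (B.augmented cols (λ i → symbolB (x i)) (proj₂ (Labels.to y))))
    where
    split⇔ : ∀ r →
      ((Agrees A.arr (proj₁ cols) (λ i → symbolA (x i)) (rowA r) × A.last (rowA r) ≡ proj₁ (Labels.to y))
       × (Agrees B.arr (proj₁ cols) (λ i → symbolB (x i)) (rowB r) × B.last (rowB r) ≡ proj₂ (Labels.to y)))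
      ⇔ (Agrees arr (proj₁ cols) x r × last r ≡ y)
    split⇔ r = mk⇔
      (λ ((agreeA , lastA) , (agreeB , lastB)) →
         Equivalence.to (Agrees-pair⇔ (proj₁ cols) x r) (agreeA , agreeB) ,
         Equivalence.from (from-≡⇔ labels) (lastA , lastB))
      (λ (agree , last≡) →
         let (agreeA , agreeB) = Equivalence.from (Agrees-pair⇔ (proj₁ cols) x r) agree
             (lastA , lastB)   = Equivalence.to (from-≡⇔ labels) last≡
         in (agreeA , lastA) , (agreeB , lastB))

  aoa : AOA s t k (m * n)
  aoa = record { arr = arr ; last = last ; isOA = isOA ; augmented = augmented }

theorem2p1 : (s t k u v : ℕ) → s ≤ t → t ≤ k → 1 ≤ u → 1 ≤ v →
    AOA s t k v → AOA s t k u → AOA s t k (u * v)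
theorem2p1 s t k u v _ _ _ _ A B = Product.aoa B A
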